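{- Let $T$ be a set of $\mathsf{BDFNL^*}$-formulas containing $\top$ and $\bot$ and closed under subformulas. For every formula $A\in c(T)$, $\Psi[T]\vdash_{\mathsf{BDFNL^*}} A\wedge A^\sim\Rightarrow_{c(T^\sim)}\bot$ and $\Psi[T]\vdash_{\mathsf{BDFNL^*}} A\vee A^\sim\Rightarrow_{c(T^\sim)}\top$.
   Context: $\mathsf{BDFNL^*}$: formulas $A::=p\mid\top\mid\bot\mid A\wedge B\mid A\vee B\mid A\cdot B\mid A\backslash B\mid A/B$; formula trees $\Gamma::=A\mid\Gamma\circ\Delta$ ($\Gamma[\Delta]$: distinguished subtree occurrence); sequents $\Gamma\Rightarrow A$ with $\Gamma$ a tree or empty. Axioms: $A\Rightarrow A$; (D) $A\wedge(B\vee C)\Rightarrow(A\wedge B)\vee(A\wedge C)$; $\Gamma[\bot]\Rightarrow A$; $\Gamma\Rightarrow\top$. Rules: from $\Delta\Rightarrow A$, $\Gamma[B]\Rightarrow C$ infer $\Gamma[\Delta\circ(A\backslash B)]\Rightarrow C$; from $A\circ\Gamma\Rightarrow B$ infer $\Gamma\Rightarrow A\backslash B$; from $\Gamma[A]\Rightarrow C$, $\Delta\Rightarrow B$ infer $\Gamma[(A/B)\circ\Delta]\Rightarrow C$; from $\Gamma\circ B\Rightarrow A$ infer $\Gamma\Rightarrow A/B$ ($\Gamma$ may be empty in these two); from $\Gamma[A\circ B]\Rightarrow C$ infer $\Gamma[A\cdot B]\Rightarrow C$; from $\Gamma\Rightarrow A$, $\Delta\Rightarrow B$ infer $\Gamma\circ\Delta\Rightarrow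 A\cdot B$; Cut: from $\Delta\Rightarrow A$, $\Gamma[A]\Rightarrow B$ infer $\Gamma[\Delta]\Rightarrow B$; from $\Gamma[A_i]\Rightarrow B$ infer $\Gamma[A_1\wedge A_2]\Rightarrow B$; from $\Gamma\Rightarrow A$, $\Gamma\Rightarrow B$ infer $\Gamma\Rightarrow A\wedge B$; from $\Gamma[A_1]\Rightarrow B$, $\Gamma[A_2]\Rightarrow B$ infer $\Gamma[A_1\vee A_2]\Rightarrow B$; from $\Gamma\Rightarrow A_i$ infer $\Gamma\Rightarrow A_1\vee A_2$. For a set $\Phi$ of sequents and a set $S$ of formulas, $\Phi\vdash_{\mathsf{BDFNL^*}}\Gamma\Rightarrow_S A$ means $\Gamma\Rightarrow A$ has a derivation using the sequents in $\Phi$ as extra axioms in which every formula occurring belongs to $S$. For a set $T$ of formulas, $c(T)$ is the closure of $T$ under $\wedge$ and $\vee$. For each $B\in T$ let $p_B$ be a fresh propositional letter, and $T^\sim=T\cup\{p_B\mid B\in T\}$. The map $(\cdot)^\sim:c(T)\to c(T^\sim)$: $\top^\sim=\bot$, $\bot^\sim=\top$; $A^\sim=p_A$ for $A\in T$, $A\neq\top,\bot$; $(A\wedge B)^\sim=A^\sim\vee B^\sim$, $(A\vee B)^\sim=A^\sim\wedge B^\sim$ otherwise. $\Psi[T]=\{A\wedge p_A\Rightarrow\bot\mid A\in T\}\cup\{A\vee p_A\Rightarrow\top\mid A\in T\}$. -}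

module Defs where

open import Data.Sum using (_⊎_; inj₁; inj₂)
open import Data.Maybe using (Maybe; just; nothing)
open import Data.Product using (_×_)
open import Relation.Nullary using (¬_)
open import Relation.Binary.PropositionalEquality using (_≡_)

-- Formulas of BDFNL* over a type V of propositional letters.
--   A under B  is  A \ B ,   A over B  is  A / B ,   A · B  is product.

infixr 30 _·_
infixr 25 _∧_
infixr 24 _∨_

data Fm (V : Set) : Set where
  var   : V → Fm V
  top   : Fm V
  bot   : Fm V
  _∧_   : Fm V → Fm V → Fm V
  _∨_   : Fm V → Fm V → Fm V
  _·_   : Fm V → Fm V → Fm V
  _under_ : Fm V → Fm V → Fm V
  _over_  : Fm V → Fm V → Fm V

data Tree (V : Set) : Set where
  leaf : Fm V → Tree V
  _⊙_  : Tree V → Tree V → Tree V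

data Ctx (V : Set) : Set where
  hole : Ctx V
  _◂_  : Ctx V → Tree V → Ctx V
  _▸_  : Tree V → Ctx V → Ctx V

_[_] : {V : Set} → Ctx V → Tree V → Tree V
hole [ Δ ] = Δ
(Γ ◂ Θ) [ Δ ] = (Γ [ Δ ]) ⊙ Θ
(Θ ▸ Γ) [ Δ ] = Θ ⊙ (Γ [ Δ ])

-- Sequents  Γ ⇒ A  with Γ a tree or empty (nothing).
infix 10 _⇒_
data Seq (V : Set) : Set where
  _⇒_ : Maybe (Tree V) → Fm V → Seq V

consL : {V : Set} → Fm V → Maybe (Tree V) → Tree V
consL A nothing  = leaf A
consL A (just Γ) = leaf A ⊙ Γ

snocR : {V : Set} → Maybe (Tree V) → Fm V → Tree V
snocR nothing  B = leaf B
snocR (just Γ) B = Γ ⊙ leaf B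

data TreeIn {V : Set} (S : Fm V → Set) : Tree V → Set where
  leaf-in : {A : Fm V} → S A → TreeIn S (leaf A)
  node-in : {Γ Δ : Tree V} → TreeIn S Γ → TreeIn S Δ → TreeIn S (Γ ⊙ Δ)

data AnteIn {V : Set} (S : Fm V → Set) : Maybe (Tree V) → Set where
  empty-in : AnteIn S nothing
  tree-in  : {Γ : Tree V} → TreeIn S Γ → AnteIn S (just Γ)

data SeqIn {V : Set} (S : Fm V → Set) : Seq V → Set where
  seq-in : {Γ : Maybe (Tree V)} {A : Fm V} → AnteIn S Γ → S A → SeqIn S (Γ ⇒ A)

-- Φ ⊢ Γ ⇒_S A : derivations in BDFNL* from extra axioms Φ in which every
-- sequent (hence every formula occurring) is built from formulas in S.

data Der {V : Set} (Φ : Seq V → Set) (S : Fm V → Set) : Seq V → Set where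
  hyp   : {s : Seq V} → Φ s → SeqIn S s → Der Φ S s
  id    : {A : Fm V} → SeqIn S (just (leaf A) ⇒ A) → Der Φ S (just (leaf A) ⇒ A)
  dist  : {A B C : Fm V} →
          SeqIn S (just (leaf (A ∧ (B ∨ C))) ⇒ (A ∧ B) ∨ (A ∧ C)) →
          Der Φ S (just (leaf (A ∧ (B ∨ C))) ⇒ (A ∧ B) ∨ (A ∧ C))
  botL  : {A : Fm V} (Γ : Ctx V) → SeqIn S (just (Γ [ leaf bot ]) ⇒ A) →
          Der Φ S (just (Γ [ leaf bot ]) ⇒ A)
  topR  : (Γ : Maybe (Tree V)) → SeqIn S (Γ ⇒ top) → Der Φ S (Γ ⇒ top)
  underL : {A B C : Fm V} (Γ : Ctx V) (Δ : Tree V) →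
          Der Φ S (just Δ ⇒ A) → Der Φ S (just (Γ [ leaf B ]) ⇒ C) →
          SeqIn S (just (Γ [ Δ ⊙ leaf (A under B) ]) ⇒ C) →
          Der Φ S (just (Γ [ Δ ⊙ leaf (A under B) ]) ⇒ C)
  underR : {A B : Fm V} (Γ : Maybe (Tree V)) →
          Der Φ S (just (consL A Γ) ⇒ B) → SeqIn S (Γ ⇒ A under B) →
          Der Φ S (Γ ⇒ A under B)
  overL : {A B C : Fm V} (Γ : Ctx V) (Δ : Tree V) →
          Der Φ S (just (Γ [ leaf A ]) ⇒ C) → Der Φ S (just Δ ⇒ B) →
          SeqIn S (just (Γ [ leaf (A over B) ⊙ Δ ]) ⇒ C) →
          Der Φ S (just (Γ [ leaf (A over B) ⊙ Δ ]) ⇒ C)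
  overR : {A B : Fm V} (Γ : Maybe (Tree V)) →
          Der Φ S (just (snocR Γ B) ⇒ A) → SeqIn S (Γ ⇒ A over B) →
          Der Φ S (Γ ⇒ A over B)
  dotL  : {A B C : Fm V} (Γ : Ctx V) →
          Der Φ S (just (Γ [ leaf A ⊙ leaf B ]) ⇒ C) →
          SeqIn S (just (Γ [ leaf (A · B) ]) ⇒ C) →
          Der Φ S (just (Γ [ leaf (A · B) ]) ⇒ C)
  dotR  : {A B : Fm V} (Γ Δ : Tree V) →
          Der Φ S (just Γ ⇒ A) → Der Φ S (just Δ ⇒ B) →
          SeqIn S (just (Γ ⊙ Δ) ⇒ A · B) →
          Der Φ S (just (Γ ⊙ Δ) ⇒ A · B)
  cut   : {A B : Fm V} (Γ : Ctx V) (Δ : Tree V) →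
          Der Φ S (just Δ ⇒ A) → Der Φ S (just (Γ [ leaf A ]) ⇒ B) →
          SeqIn S (just (Γ [ Δ ]) ⇒ B) →
          Der Φ S (just (Γ [ Δ ]) ⇒ B)
  andL₁ : {A₁ A₂ B : Fm V} (Γ : Ctx V) →
          Der Φ S (just (Γ [ leaf A₁ ]) ⇒ B) →
          SeqIn S (just (Γ [ leaf (A₁ ∧ A₂) ]) ⇒ B) →
          Der Φ S (just (Γ [ leaf (A₁ ∧ A₂) ]) ⇒ B)
  andL₂ : {A₁ A₂ B : Fm V} (Γ : Ctx V) →
          Der Φ S (just (Γ [ leaf A₂ ]) ⇒ B) →
          SeqIn S (just (Γ [ leaf (A₁ ∧ A₂) ]) ⇒ B) →
          Der Φ S (just (Γ [ leaf (A₁ ∧ A₂) ]) ⇒ B)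
  andR  : {A B : Fm V} (Γ : Maybe (Tree V)) →
          Der Φ S (Γ ⇒ A) → Der Φ S (Γ ⇒ B) → SeqIn S (Γ ⇒ A ∧ B) →
          Der Φ S (Γ ⇒ A ∧ B)
  orL   : {A₁ A₂ B : Fm V} (Γ : Ctx V) →
          Der Φ S (just (Γ [ leaf A₁ ]) ⇒ B) →
          Der Φ S (just (Γ [ leaf A₂ ]) ⇒ B) →
          SeqIn S (just (Γ [ leaf (A₁ ∨ A₂) ]) ⇒ B) →
          Der Φ S (just (Γ [ leaf (A₁ ∨ A₂) ]) ⇒ B)
  orR₁  : {A₁ A₂ : Fm V} (Γ : Maybe (Tree V)) →
          Der Φ S (Γ ⇒ A₁) → SeqIn S (Γ ⇒ A₁ ∨ A₂) → Der Φ S (Γ ⇒ A₁ ∨ A₂)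
  orR₂  : {A₁ A₂ : Fm V} (Γ : Maybe (Tree V)) →
          Der Φ S (Γ ⇒ A₂) → SeqIn S (Γ ⇒ A₁ ∨ A₂) → Der Φ S (Γ ⇒ A₁ ∨ A₂)

data ImmSub {V : Set} : Fm V → Fm V → Set where
  ∧ˡ : {A B : Fm V} → ImmSub A (A ∧ B)
  ∧ʳ : {A B : Fm V} → ImmSub B (A ∧ B)
  ∨ˡ : {A B : Fm V} → ImmSub A (A ∨ B)
  ∨ʳ : {A B : Fm V} → ImmSub B (A ∨ B)
  ·ˡ : {A B : Fm V} → ImmSub A (A · B)
  ·ʳ : {A B : Fm V} → ImmSub B (A · B)
  underˡ : {A B : Fm V} → ImmSub A (A under B)
  underʳ : {A B : Fm V} → ImmSub B (A under B)
  overˡ  : {A B : Fm V} → ImmSub A (A over B)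
  overʳ  : {A B : Fm V} → ImmSub B (A over B)

SubClosed : {V : Set} → (Fm V → Set) → Set
SubClosed {V} T = {A B : Fm V} → ImmSub A B → T B → T A

data c {V : Set} (T : Fm V → Set) : Fm V → Set where
  base : {A : Fm V} → T A → c T A
  and  : {A B : Fm V} → c T A → c T B → c T (A ∧ B)
  or   : {A B : Fm V} → c T A → c T B → c T (A ∨ B)

-- Extended letters: old letters inj₁ x, fresh letters p_B = inj₂ B.
V⁺ : Set → Set
V⁺ V = V ⊎ Fm V

emb : {V : Set} → Fm V → Fm (V⁺ V)
emb (var x) = var (inj₁ x)
emb top = top
emb bot = bot
emb (A ∧ B) = emb A ∧ emb B
emb (A ∨ B) = emb A ∨ emb B
emb (A · B) = emb A · emb B
emb (A under B) = emb A under emb B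
emb (A over B) = emb A over emb B

p : {V : Set} → Fm V → Fm (V⁺ V)
p B = var (inj₂ B)

data T∼ {V : Set} (T : Fm V → Set) : Fm (V⁺ V) → Set where
  old   : {A : Fm V} → T A → T∼ T (emb A)
  fresh : {A : Fm V} → T A → T∼ T (p A)

-- Graph of the map (·)^∼ : c(T) → c(T^∼), following the defining clauses
-- (⊤, ⊥; members of T; otherwise by ∧/∨ recursion).
data Tilde {V : Set} (T : Fm V → Set) : Fm V → Fm (V⁺ V) → Set where
  t-top : Tilde T top bot
  t-bot : Tilde T bot top
  t-T   : {A : Fm V} → T A → ¬ (A ≡ top) → ¬ (A ≡ bot) → Tilde T A (p A)
  t-and : {A B : Fm V} {A' B' : Fm (V⁺ V)} → ¬ T (A ∧ B) →
          Tilde T A A' → Tilde T B B' → Tilde T (A ∧ B) (A' ∨ B')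
  t-or  : {A B : Fm V} {A' B' : Fm (V⁺ V)} → ¬ T (A ∨ B) →
          Tilde T A A' → Tilde T B B' → Tilde T (A ∨ B) (A' ∧ B')

data Ψ {V : Set} (T : Fm V → Set) : Seq (V⁺ V) → Set where
  ψ-bot : {A : Fm V} → T A → Ψ T (just (leaf (emb A ∧ p A)) ⇒ bot)
  ψ-top : {A : Fm V} → T A → Ψ T (just (leaf (emb A ∨ p A)) ⇒ top)

module Submission where

open import Defs
open import Data.Maybe using (just)
open import Data.Product using (_×_; _,_)

Der⇒SeqIn : {W : Set} {Φ : Seq W → Set} {S : Fm W → Set} {s : Seq W} →
            Der Φ S s → SeqIn S s
Der⇒SeqIn (hyp _ i)           = i
Der⇒SeqIn (id i)              = i
Der⇒SeqIn (dist i)            = i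
Der⇒SeqIn (botL _ i)          = i
Der⇒SeqIn (topR _ i)          = i
Der⇒SeqIn (underL _ _ _ _ i)  = i
Der⇒SeqIn (underR _ _ i)      = i
Der⇒SeqIn (overL _ _ _ _ i)   = i
Der⇒SeqIn (overR _ _ i)       = i
Der⇒SeqIn (dotL _ _ i)        = i
Der⇒SeqIn (dotR _ _ _ _ i)    = i
Der⇒SeqIn (cut _ _ _ _ i)     = i
Der⇒SeqIn (andL₁ _ _ i)       = i
Der⇒SeqIn (andL₂ _ _ i)       = i
Der⇒SeqIn (andR _ _ _ i)      = i
Der⇒SeqIn (orL _ _ _ i)       = i
Der⇒SeqIn (orR₁ _ _ i)        = i
Der⇒SeqIn (orR₂ _ _ i)        = i

module Fragment {W : Set} (Φ : Seq W → Set) (U : Fm W → Set) where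

  infix 5 _⊢_
  _⊢_ : Fm W → Fm W → Set
  X ⊢ Y = Der Φ (c U) (just (leaf X) ⇒ Y)

  leaf-seq-in : {X Y : Fm W} → c U X → c U Y → SeqIn (c U) (just (leaf X) ⇒ Y)
  leaf-seq-in x y = seq-in (tree-in (leaf-in x)) y

  ⊢-in : {X Y : Fm W} → X ⊢ Y → c U X × c U Y
  ⊢-in d with Der⇒SeqIn d
  ... | seq-in (tree-in (leaf-in x)) y = x , y

  refl⊢ : {X : Fm W} → c U X → X ⊢ X
  refl⊢ x = id (leaf-seq-in x x)

  infixr 4 _⨾_
  _⨾_ : {X Y Z : Fm W} → X ⊢ Y → Y ⊢ Z → X ⊢ Z
  d ⨾ e with ⊢-in d | ⊢-in e
  ... | x , _ | _ , z = cut hole (leaf _) d e (leaf-seq-in x z)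

  ∧-elimˡ : {X Y : Fm W} → c U X → c U Y → X ∧ Y ⊢ X
  ∧-elimˡ x y = andL₁ hole (refl⊢ x) (leaf-seq-in (and x y) x)

  ∧-elimʳ : {X Y : Fm W} → c U X → c U Y → X ∧ Y ⊢ Y
  ∧-elimʳ x y = andL₂ hole (refl⊢ y) (leaf-seq-in (and x y) y)

  ∧-pair : {X Y Z : Fm W} → X ⊢ Y → X ⊢ Z → X ⊢ Y ∧ Z
  ∧-pair d e with ⊢-in d | ⊢-in e
  ... | x , y | _ , z = andR (just _) d e (leaf-seq-in x (and y z))

  ∧-mono : {X X′ Y Y′ : Fm W} → X ⊢ X′ → Y ⊢ Y′ → X ∧ Y ⊢ X′ ∧ Y′
  ∧-mono d e with ⊢-in d | ⊢-in e
  ... | x , x′ | y , y′ =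
    ∧-pair (andL₁ hole d (leaf-seq-in (and x y) x′))
           (andL₂ hole e (leaf-seq-in (and x y) y′))

  ∧-comm : {X Y : Fm W} → c U X → c U Y → X ∧ Y ⊢ Y ∧ X
  ∧-comm x y = ∧-pair (∧-elimʳ x y) (∧-elimˡ x y)

  ∧-∨-elimʳ : {X Y Y′ Z : Fm W} → c U X → c U Y → c U Y′ →
              X ∧ Y ⊢ Z → X ∧ Y′ ⊢ Z → X ∧ (Y ∨ Y′) ⊢ Z
  ∧-∨-elimʳ x y y′ d e with ⊢-in d
  ... | _ , z =
    dist (leaf-seq-in (and x (or y y′)) (or (and x y) (and x y′)))
    ⨾ orL hole d e (leaf-seq-in (or (and x y) (and x y′)) z)

  ∧-∨-elimˡ : {X Y Y′ Z : Fm W} → c U X → c U Y → c U Y′ →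
              Y ∧ X ⊢ Z → Y′ ∧ X ⊢ Z → (Y ∨ Y′) ∧ X ⊢ Z
  ∧-∨-elimˡ x y y′ d e =
    ∧-comm (or y y′) x ⨾ ∧-∨-elimʳ x y y′ (∧-comm x y ⨾ d) (∧-comm x y′ ⨾ e)

module _ {V : Set} (T : Fm V → Set) (T⊤ : T top) (T⊥ : T bot) (sub : SubClosed T) where

  open Fragment (Ψ T) (T∼ T)

  c-∧⁻ : {A B : Fm V} → c T (A ∧ B) → c T A × c T B
  c-∧⁻ (base t)  = base (sub ∧ˡ t) , base (sub ∧ʳ t)
  c-∧⁻ (and a b) = a , b

  c-∨⁻ : {A B : Fm V} → c T (A ∨ B) → c T A × c T B
  c-∨⁻ (base t) = base (sub ∨ˡ t) , base (sub ∨ʳ t)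
  c-∨⁻ (or a b) = a , b

  c-emb : {A : Fm V} → c T A → c (T∼ T) (emb A)
  c-emb (base t)  = base (old t)
  c-emb (and a b) = and (c-emb a) (c-emb b)
  c-emb (or a b)  = or (c-emb a) (c-emb b)

  c-tilde : {A : Fm V} {A∼ : Fm (V⁺ V)} → c T A → Tilde T A A∼ → c (T∼ T) A∼
  c-tilde _ t-top          = base (old T⊥)
  c-tilde _ t-bot          = base (old T⊤)
  c-tilde _ (t-T t _ _)    = base (fresh t)
  c-tilde a (t-and _ l r) with c-∧⁻ a
  ... | a₁ , a₂ = or (c-tilde a₁ l) (c-tilde a₂ r)
  c-tilde a (t-or _ l r) with c-∨⁻ a
  ... | a₁ , a₂ = and (c-tilde a₁ l) (c-tilde a₂ r)

  -- Through (D), A ∧ A∼ splits into disjuncts each containing some Aᵢ ∧ Aᵢ∼.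
  emb∧tilde⊢⊥ : {A : Fm V} {A∼ : Fm (V⁺ V)} → c T A → Tilde T A A∼ → emb A ∧ A∼ ⊢ bot
  emb∧tilde⊢⊥ _ t-top = ∧-elimʳ (base (old T⊤)) (base (old T⊥))
  emb∧tilde⊢⊥ _ t-bot = ∧-elimˡ (base (old T⊥)) (base (old T⊤))
  emb∧tilde⊢⊥ _ (t-T t _ _) =
    hyp (ψ-bot t) (leaf-seq-in (and (base (old t)) (base (fresh t))) (base (old T⊥)))
  emb∧tilde⊢⊥ a (t-and _ l r) with c-∧⁻ a
  ... | a₁ , a₂ =
    ∧-∨-elimʳ (and e₁ e₂) (c-tilde a₁ l) (c-tilde a₂ r)
      (∧-mono (∧-elimˡ e₁ e₂) (refl⊢ (c-tilde a₁ l)) ⨾ emb∧tilde⊢⊥ a₁ l)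
      (∧-mono (∧-elimʳ e₁ e₂) (refl⊢ (c-tilde a₂ r)) ⨾ emb∧tilde⊢⊥ a₂ r)
    where e₁ = c-emb a₁ ; e₂ = c-emb a₂
  emb∧tilde⊢⊥ a (t-or _ l r) with c-∨⁻ a
  ... | a₁ , a₂ =
    ∧-∨-elimˡ (and t₁ t₂) (c-emb a₁) (c-emb a₂)
      (∧-mono (refl⊢ (c-emb a₁)) (∧-elimˡ t₁ t₂) ⨾ emb∧tilde⊢⊥ a₁ l)
      (∧-mono (refl⊢ (c-emb a₂)) (∧-elimʳ t₁ t₂) ⨾ emb∧tilde⊢⊥ a₂ r)
    where t₁ = c-tilde a₁ l ; t₂ = c-tilde a₂ r

  emb∨tilde⊢⊤ : {A : Fm V} {A∼ : Fm (V⁺ V)} → c T A → Tilde T A A∼ → emb A ∨ A∼ ⊢ top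
  emb∨tilde⊢⊤ a t = topR (just _) (leaf-seq-in (or (c-emb a) (c-tilde a t)) (base (old T⊤)))

lemma4 : {V : Set} (T : Fm V → Set) → T top → T bot → SubClosed T →
    {A : Fm V} {A∼ : Fm (V⁺ V)} → c T A → Tilde T A A∼ →
    Der (Ψ T) (c (T∼ T)) (just (leaf (emb A ∧ A∼)) ⇒ bot)
    × Der (Ψ T) (c (T∼ T)) (just (leaf (emb A ∨ A∼)) ⇒ top)
lemma4 T T⊤ T⊥ sub a t = emb∧tilde⊢⊥ T T⊤ T⊥ sub a t , emb∨tilde⊢⊤ T T⊤ T⊥ sub a t
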